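{- Let $S$ be a set of integers with $1\in S$. Let $G$ be a graph, $k$ and $c$ nonnegative integers, and $Y\subseteq V(G)$ with $|Y|\le k$. If $G-X$ is $S$-achieved $c$-choosable for every set $X$ with $X\supseteq Y$ and $|X|\le 2|Y|$, then $G$ is $S$-achieved $(c+2k)$-choosable. Likewise, if $G-X$ is properly $S$-achieved $c$-colorable for every set $X$ with $X\supseteq Y$ and $|X|\le 2|Y|$, then $G$ is properly $S$-achieved $(c+2k)$-colorable.
   Context: All graphs are finite and simple. A coloring $\phi$ is $S$-achieved if for every vertex $v$ with nonempty open neighbourhood $N(v)$ there are $s_v\in S$ and a color appearing exactly $s_v$ times on $N(v)$. A graph is properly $S$-achieved $m$-colorable if it has a proper $S$-achieved coloring using colors from $\{1,\dots,m\}$, and $S$-achieved $m$-choosable if for every assignment of lists $L(v)$ with $|L(v)|\ge m$ there is a proper $S$-achieved coloring with $\phi(v)\in L(v)$ for all $v$. -}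

module Defs where

open import Data.Nat using (ℕ; _≤_; _*_; _+_)
open import Data.Nat.Properties using (_≟_)
open import Data.Integer using (ℤ; +_)
open import Data.Bool using (Bool; true; false; _∧_; T)
open import Data.Fin using (Fin)
open import Data.Fin.Subset using (Subset; _∈_; _∉_; _⊆_; ∣_∣; ∁; ⊤)
open import Data.Fin.Subset.Properties using (_∈?_)
open import Data.List using (List; length; filter; allFin)
open import Data.List.Membership.Propositional renaming (_∈_ to _∈ₗ_)
open import Data.List.Relation.Unary.Unique.Propositional using (Unique)
open import Data.Product using (Σ; ∃; _×_)
open import Relation.Nullary using (¬_; does)
open import Relation.Binary.PropositionalEquality using (_≡_; _≢_)

record Graph (n : ℕ) : Set where
  field
    adj   : Fin n → Fin n → Bool
    sym   : ∀ u v → adj u v ≡ adj v u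
    irrfl : ∀ v → adj v v ≡ false
open Graph public

Coloring : ℕ → Set
Coloring n = Fin n → ℕ

IntSet : Set₁
IntSet = ℤ → Set

-- All statements below are about the induced subgraph G[W] of G on the
-- vertex set W ⊆ V(G); G - X is G[∁ X], and G itself is G[⊤].

NbrIn : ∀ {n} → Graph n → Subset n → Fin n → Fin n → Set
NbrIn G W v u = u ∈ W × T (adj G v u)

countColor : ∀ {n} → Graph n → Subset n → Coloring n → Fin n → ℕ → ℕ
countColor {n} G W φ v a =
  length (filter (λ u → u ∈? W) (filter (λ u → φ u ≟ a) (filter (λ u → Data.Bool._≟_ (adj G v u) true) (allFin n))))

SAchieved : ∀ {n} → IntSet → Graph n → Subset n → Coloring n → Set
SAchieved S G W φ =
  ∀ v → v ∈ W → (∃ λ u → NbrIn G W v u) →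
    Σ ℕ λ a → S (+ countColor G W φ v a)

Proper : ∀ {n} → Graph n → Subset n → Coloring n → Set
Proper G W φ = ∀ u v → u ∈ W → v ∈ W → T (adj G u v) → φ u ≢ φ v

PropSAchColorable : ∀ {n} → IntSet → Graph n → Subset n → ℕ → Set
PropSAchColorable {n} S G W m =
  Σ (Coloring n) λ φ → Proper G W φ × SAchieved S G W φ ×
    (∀ v → v ∈ W → 1 ≤ φ v × φ v ≤ m)

-- G[W] is S-achieved m-choosable. A list L(v) is a duplicate-free list
-- of colors (a finite set of colors), |L(v)| = its length.
SAchChoosable : ∀ {n} → IntSet → Graph n → Subset n → ℕ → Set
SAchChoosable {n} S G W m =
  (L : Fin n → List ℕ) → (∀ v → v ∈ W → Unique (L v)) →
  (∀ v → v ∈ W → m ≤ length (L v)) →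
  Σ (Coloring n) λ φ → Proper G W φ × SAchieved S G W φ ×
    (∀ v → v ∈ W → φ v ∈ₗ L v)

{-# OPTIONS --safe #-}
-- Enlarge Y to a set X of at most 2|Y| vertices by adding one neighbour of each vertex of Y;
-- then every vertex of X that is not isolated in G has a neighbour in X. Color X injectively
-- with at most 2k colors kept away from G − X (the 2k extra list entries, resp. the colors
-- c+1, …, c+2k), and color G − X by hypothesis. A vertex with a neighbour w in X sees the
-- color of w exactly once, and 1 ∈ S; every other vertex lies outside X with all neighbours
-- outside X, so it sees the same color counts as in G − X.
module Submission where

open import Defs hiding (sym)
open import Data.Nat using (ℕ; zero; suc; _≤_; _<_; _+_; _*_; z≤n; s≤s)
import Data.Nat as ℕ
open import Data.Nat.Properties
  using (≤-reflexive; ≤-trans; ≤-antisym; <-≤-trans; <⇒≢; <⇒≱; suc-injective; m≤m+n; m≤n+m;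
         +-comm; +-suc; +-identityʳ; +-cancelˡ-≡; +-cancelʳ-≤; +-monoʳ-≤; *-monoʳ-≤; module ≤-Reasoning)
open import Data.Integer using (+_)
open import Data.Bool using (T; true) renaming (_≟_ to _≟ᵇ_)
open import Data.Bool.Properties using (T?; T-≡)
open import Data.Fin using (Fin; zero; suc)
import Data.Fin.Properties as Fin
open import Data.Fin.Subset using (Subset; _∈_; _∉_; _⊆_; ∣_∣; ∁; ⊤; ⊥; ⁅_⁆; _∪_; inside; outside)
open import Data.Fin.Subset.Properties
  using (_∈?_; ∈⊤; ∉⊥; x∈⁅x⁆; x∈⁅y⁆⇒x≡y; x∈p∪q⁺; x∈p∪q⁻; drop-there; x∉p⇒x∈∁p)
open import Data.Vec using ([]; _∷_; here; there)
open import Data.List using (List; []; _∷_; length; filter; map; _++_; allFin; tabulate; applyUpTo; foldr)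
open import Data.List.Properties
  using (filter-notAll; filter-accept; filter-reject; length-map; length-++; length-applyUpTo)
open import Data.List.Membership.Propositional using (find) renaming (_∈_ to _∈ₗ_; _∉_ to _∉ₗ_)
open import Data.List.Membership.Propositional.Properties
  using (∈-filter⁺; ∈-filter⁻; ∈-allFin; ∈-map⁺; ∈-map⁻; ∈-++⁺ˡ; ∈-++⁺ʳ; ∈-++⁻; ∈-applyUpTo⁻)
import Data.List.Membership.DecPropositional as DecMembership
open import Data.List.Relation.Binary.Subset.Propositional renaming (_⊆_ to _⊆ₗ_)
open import Data.List.Relation.Unary.Any as Any using (Any; here; there)
open import Data.List.Relation.Unary.All as All using ([]; all?)
open import Data.List.Relation.Unary.All.Properties using (¬All⇒Any¬)
open import Data.List.Relation.Unary.AllPairs using ([]; _∷_)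
open import Data.List.Relation.Unary.Unique.Propositional using (Unique)
open import Data.List.Relation.Unary.Unique.Propositional.Properties using (filter⁺; allFin⁺; applyUpTo⁺₁)
open import Data.Product using (∃; _×_; _,_; proj₁; proj₂; map₂)
open import Data.Sum using (_⊎_; inj₁; inj₂)
open import Function using (_∘_; id; _⇔_; mk⇔; Equivalence)
open Equivalence using (to; from)
open import Level using (Level)
open import Relation.Nullary using (¬_; yes; no; ¬?; _×-dec_; contradiction)
open import Relation.Unary using (Pred; Decidable)
open import Relation.Binary.Definitions using (DecidableEquality)
open import Relation.Binary.PropositionalEquality
  using (_≡_; _≢_; refl; sym; trans; cong; subst; module ≡-Reasoning)

module _ {A : Set} {ℓ : Level} {P : Pred A ℓ} (P? : Decidable P) where

  length-filter-complement : ∀ xs → length xs ≡ length (filter P? xs) + length (filter (¬? ∘ P?) xs)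
  length-filter-complement [] = refl
  length-filter-complement (x ∷ xs) with P? x
  ... | yes _ = cong suc (length-filter-complement xs)
  ... | no  _ = trans (cong suc (length-filter-complement xs)) (sym (+-suc _ _))

  private
    ⇔-tail : ∀ {n s} {p : Subset n} {f : Fin (suc n) → A} →
      (∀ i → P (f i) ⇔ i ∈ s ∷ p) → ∀ i → P (f (suc i)) ⇔ i ∈ p
    ⇔-tail P∘f⇔p i = mk⇔ (drop-there ∘ to (P∘f⇔p (suc i))) (from (P∘f⇔p (suc i)) ∘ there)

  length-filter-tabulate : ∀ {n} (p : Subset n) (f : Fin n → A) → (∀ i → P (f i) ⇔ i ∈ p) →
    length (filter P? (tabulate f)) ≡ ∣ p ∣
  length-filter-tabulate []            f _      = refl
  length-filter-tabulate (inside ∷ p)  f P∘f⇔p =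
    trans (cong length (filter-accept P? (from (P∘f⇔p zero) here)))
          (cong suc (length-filter-tabulate p (f ∘ suc) (⇔-tail P∘f⇔p)))
  length-filter-tabulate (outside ∷ p) f P∘f⇔p =
    trans (cong length (filter-reject P? ((λ ()) ∘ to (P∘f⇔p zero))))
          (length-filter-tabulate p (f ∘ suc) (⇔-tail P∘f⇔p))

module _ {A : Set} (_≟_ : DecidableEquality A) where

  open DecMembership _≟_ using () renaming (_∈?_ to _∈ₗ?_; _∉?_ to _∉ₗ?_)

  Unique-⊆⇒length≤ : ∀ {xs ys : List A} → Unique xs → xs ⊆ₗ ys → length xs ≤ length ys
  Unique-⊆⇒length≤ {[]} _ _ = z≤n
  Unique-⊆⇒length≤ {x ∷ xs} {ys} (x∉xs ∷ xs!) x∷xs⊆ys =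
    <-≤-trans (s≤s (Unique-⊆⇒length≤ xs! xs⊆ys-x))
              (filter-notAll (λ y → ¬? (x ≟ y)) ys (Any.map (λ x≡y x≢y → x≢y x≡y) (x∷xs⊆ys (here refl))))
    where
    xs⊆ys-x : xs ⊆ₗ filter (λ y → ¬? (x ≟ y)) ys
    xs⊆ys-x z∈xs = ∈-filter⁺ (λ y → ¬? (x ≟ y)) (x∷xs⊆ys (there z∈xs)) (All.lookup x∉xs z∈xs)

  Unique-⊆-antisym⇒length≡ : ∀ {xs ys : List A} → Unique xs → Unique ys →
    xs ⊆ₗ ys → ys ⊆ₗ xs → length xs ≡ length ys
  Unique-⊆-antisym⇒length≡ xs! ys! xs⊆ys ys⊆xs =
    ≤-antisym (Unique-⊆⇒length≤ xs! xs⊆ys) (Unique-⊆⇒length≤ ys! ys⊆xs)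

  Unique-length<⇒∃∉ : ∀ {xs ys : List A} → Unique xs → length ys < length xs →
    ∃ λ x → x ∈ₗ xs × x ∉ₗ ys
  Unique-length<⇒∃∉ {xs} {ys} xs! ys<xs with all? (_∈ₗ? ys) xs
  ... | yes xs⊆ys = contradiction (Unique-⊆⇒length≤ xs! (All.lookup xs⊆ys)) (<⇒≱ ys<xs)
  ... | no  xs⊈ys = find (¬All⇒Any¬ (_∈ₗ? ys) xs xs⊈ys)

  length≤length-filter-∉+length : ∀ {xs} ys → Unique xs →
    length xs ≤ length (filter (_∉ₗ? ys) xs) + length ys
  length≤length-filter-∉+length {xs} ys xs! = begin
    length xs                                                    ≡⟨ length-filter-complement (_∈ₗ? ys) xs ⟩
    length (filter (_∈ₗ? ys) xs) + length (filter (_∉ₗ? ys) xs)  ≡⟨ +-comm (length (filter (_∈ₗ? ys) xs)) _ ⟩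
    length (filter (_∉ₗ? ys) xs) + length (filter (_∈ₗ? ys) xs)  ≤⟨ +-monoʳ-≤ _ in-ys≤ys ⟩
    length (filter (_∉ₗ? ys) xs) + length ys                     ∎
    where
    open ≤-Reasoning
    in-ys≤ys : length (filter (_∈ₗ? ys) xs) ≤ length ys
    in-ys≤ys = Unique-⊆⇒length≤ (filter⁺ (_∈ₗ? ys) xs!) (λ x∈ → proj₂ (∈-filter⁻ (_∈ₗ? ys) {xs = xs} x∈))

record Representatives {A : Set} (Dom : A → Set) (L : A → List ℕ) : Set where
  field
    rep           : A → ℕ
    rep∈L         : ∀ {z} → Dom z → rep z ∈ₗ L z
    rep-injective : ∀ {z w} → Dom z → Dom w → rep z ≡ rep w → z ≡ w

module _ {A : Set} (_≟_ : DecidableEquality A) where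

  -- Greedy choice: when z is reached, fewer colors are taken than L z has elements.
  distinctRepresentatives : (L : A → List ℕ) (zs : List A) → Unique zs →
    (∀ {z} → z ∈ₗ zs → Unique (L z)) → (∀ {z} → z ∈ₗ zs → length zs ≤ length (L z)) →
    Representatives (_∈ₗ zs) L
  distinctRepresentatives L [] _ _ _ = record { rep = λ _ → 0 ; rep∈L = λ () ; rep-injective = λ () }
  distinctRepresentatives L (z ∷ zs) (z∉zs ∷ zs!) L! L-long = record
    { rep = g′ ; rep∈L = g′∈L ; rep-injective = g′-inj }
    where
    open Representatives (distinctRepresentatives L zs zs! (L! ∘ there) (≤-trans (m≤n+m _ 1) ∘ L-long ∘ there))
      renaming (rep to g; rep∈L to g∈L; rep-injective to g-inj)

    fresh : ∃ λ a → a ∈ₗ L z × a ∉ₗ map g zs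
    fresh = Unique-length<⇒∃∉ ℕ._≟_ (L! (here refl))
              (subst (_< length (L z)) (sym (length-map g zs)) (L-long (here refl)))

    a : ℕ
    a = proj₁ fresh

    g′ : A → ℕ
    g′ x with x ≟ z
    ... | yes _ = a
    ... | no  _ = g x

    g′-head : g′ z ≡ a
    g′-head with z ≟ z
    ... | yes _   = refl
    ... | no  z≢z = contradiction refl z≢z

    g′-tail : ∀ {x} → x ∈ₗ zs → g′ x ≡ g x
    g′-tail {x} x∈zs with x ≟ z
    ... | yes refl = contradiction x∈zs (λ z∈zs → All.lookup z∉zs z∈zs refl)
    ... | no  _    = refl

    head-fresh : ∀ {w} → w ∈ₗ zs → g′ z ≢ g′ w
    head-fresh w∈zs g′z≡g′w = proj₂ (proj₂ fresh)
      (subst (_∈ₗ map g zs) (trans (sym (g′-tail w∈zs)) (trans (sym g′z≡g′w) g′-head)) (∈-map⁺ g w∈zs))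

    g′∈L : ∀ {x} → x ∈ₗ z ∷ zs → g′ x ∈ₗ L x
    g′∈L (here refl)  = subst (_∈ₗ L z) (sym g′-head) (proj₁ (proj₂ fresh))
    g′∈L (there x∈zs) = subst (_∈ₗ L _) (sym (g′-tail x∈zs)) (g∈L x∈zs)

    g′-inj : ∀ {x w} → x ∈ₗ z ∷ zs → w ∈ₗ z ∷ zs → g′ x ≡ g′ w → x ≡ w
    g′-inj (here refl)  (here refl)  _ = refl
    g′-inj (here refl)  (there w∈zs) e = contradiction e (head-fresh w∈zs)
    g′-inj (there x∈zs) (here refl)  e = contradiction (sym e) (head-fresh x∈zs)
    g′-inj (there x∈zs) (there w∈zs) e =
      g-inj x∈zs w∈zs (trans (sym (g′-tail x∈zs)) (trans e (g′-tail w∈zs)))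

colorInterval : ℕ → ℕ → List ℕ
colorInterval c m = applyUpTo (λ i → suc (c + i)) m

colorInterval-Unique : ∀ c m → Unique (colorInterval c m)
colorInterval-Unique c m =
  applyUpTo⁺₁ _ m (λ i<j _ e → <⇒≢ i<j (+-cancelˡ-≡ c _ _ (suc-injective e)))

∈-colorInterval⁻ : ∀ {c m a} → a ∈ₗ colorInterval c m → c < a × a ≤ c + m
∈-colorInterval⁻ {c} {m} a∈ with i , i<m , refl ← ∈-applyUpTo⁻ (λ i → suc (c + i)) a∈ =
  s≤s (m≤m+n c i) , subst (_≤ c + m) (+-suc c i) (+-monoʳ-≤ c i<m)

module _ {n : ℕ} where

  toList : Subset n → List (Fin n)
  toList p = filter (_∈? p) (allFin n)

  ∈-toList⁺ : ∀ {x p} → x ∈ p → x ∈ₗ toList p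
  ∈-toList⁺ x∈p = ∈-filter⁺ (_∈? _) (∈-allFin _) x∈p

  ∈-toList⁻ : ∀ {x p} → x ∈ₗ toList p → x ∈ p
  ∈-toList⁻ {p = p} x∈ = proj₂ (∈-filter⁻ (_∈? p) {xs = allFin n} x∈)

  toList-Unique : ∀ p → Unique (toList p)
  toList-Unique p = filter⁺ (_∈? p) (allFin⁺ n)

  length-toList : ∀ p → length (toList p) ≡ ∣ p ∣
  length-toList p = length-filter-tabulate (_∈? p) p id (λ _ → mk⇔ id id)

  fromList : List (Fin n) → Subset n
  fromList = foldr (λ x p → ⁅ x ⁆ ∪ p) ⊥

  ∈-fromList⁺ : ∀ {x xs} → x ∈ₗ xs → x ∈ fromList xs
  ∈-fromList⁺ {xs = y ∷ _} (here refl) = x∈p∪q⁺ (inj₁ (x∈⁅x⁆ y))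
  ∈-fromList⁺ (there x∈xs)             = x∈p∪q⁺ (inj₂ (∈-fromList⁺ x∈xs))

  ∈-fromList⁻ : ∀ {x} xs → x ∈ fromList xs → x ∈ₗ xs
  ∈-fromList⁻ []       x∈ = contradiction x∈ ∉⊥
  ∈-fromList⁻ (y ∷ xs) x∈ with x∈p∪q⁻ ⁅ y ⁆ (fromList xs) x∈
  ... | inj₁ x∈⁅y⁆ = here (x∈⁅y⁆⇒x≡y y x∈⁅y⁆)
  ... | inj₂ x∈xs  = there (∈-fromList⁻ xs x∈xs)

  ∣fromList∣≤length : ∀ xs → ∣ fromList xs ∣ ≤ length xs
  ∣fromList∣≤length xs = subst (_≤ length xs) (length-toList (fromList xs))
    (Unique-⊆⇒length≤ Fin._≟_ (toList-Unique (fromList xs)) (∈-fromList⁻ xs ∘ ∈-toList⁻))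

  distinctRepresentativesOn : ∀ {m} (X : Subset n) → ∣ X ∣ ≤ m → (L : Fin n → List ℕ) →
    (∀ {v} → v ∈ X → Unique (L v)) → (∀ {v} → v ∈ X → m ≤ length (L v)) → Representatives (_∈ X) L
  distinctRepresentativesOn X ∣X∣≤m L L! L-long = record
    { rep           = rep
    ; rep∈L         = rep∈L ∘ ∈-toList⁺
    ; rep-injective = λ z∈X w∈X → rep-injective (∈-toList⁺ z∈X) (∈-toList⁺ w∈X)
    }
    where
    open Representatives (distinctRepresentatives Fin._≟_ L (toList X) (toList-Unique X) (L! ∘ ∈-toList⁻)
      (λ z∈ → ≤-trans (subst (_≤ _) (sym (length-toList X)) ∣X∣≤m) (L-long (∈-toList⁻ z∈))))

  merge : Subset n → Coloring n → Coloring n → Coloring n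
  merge X g ψ v with v ∈? X
  ... | yes _ = g v
  ... | no  _ = ψ v

  merge-elim : ∀ {X g ψ} (P : ℕ → Set) {v} → (v ∈ X → P (g v)) → (v ∉ X → P (ψ v)) → P (merge X g ψ v)
  merge-elim {X} P {v} P-inside P-outside with v ∈? X
  ... | yes v∈X = P-inside v∈X
  ... | no  v∉X = P-outside v∉X

  merge-∈ : ∀ {X g ψ v} → v ∈ X → merge X g ψ v ≡ g v
  merge-∈ {g = g} {v = v} v∈X = merge-elim (_≡ g v) (λ _ → refl) (contradiction v∈X)

  merge-∉ : ∀ {X g ψ v} → v ∉ X → merge X g ψ v ≡ ψ v
  merge-∉ {ψ = ψ} {v = v} v∉X = merge-elim (_≡ ψ v) (λ v∈X → contradiction v∈X v∉X) (λ _ → refl)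

module _ {n : ℕ} (G : Graph n) where

  private
    adj-sym : ∀ {u v} → T (adj G u v) → T (adj G v u)
    adj-sym {u} {v} = subst T (Graph.sym G u v)

  HasNeighbourIn : Subset n → Fin n → Set
  HasNeighbourIn W v = ∃ (NbrIn G W v)

  NoNewIsolated : Subset n → Set
  NoNewIsolated X = ∀ {v} → v ∈ X → HasNeighbourIn ⊤ v → HasNeighbourIn X v

  neighbour : Fin n → Fin n
  neighbour v with Fin.any? (λ u → T? (adj G v u))
  ... | yes (u , _) = u
  ... | no  _       = v

  neighbour-spec : ∀ v → T (adj G v (neighbour v)) ⊎ (neighbour v ≡ v × ¬ HasNeighbourIn ⊤ v)
  neighbour-spec v with Fin.any? (λ u → T? (adj G v u))
  ... | yes (_ , v~u) = inj₁ v~u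
  ... | no  isolated  = inj₂ (refl , λ (u , _ , v~u) → isolated (u , v~u))

  addNeighbours : Subset n → Subset n
  addNeighbours Y = fromList (toList Y ++ map neighbour (toList Y))

  ∈-addNeighbours⁺ : ∀ {Y y} → y ∈ Y → y ∈ addNeighbours Y × neighbour y ∈ addNeighbours Y
  ∈-addNeighbours⁺ {Y} y∈Y =
    ∈-fromList⁺ (∈-++⁺ˡ (∈-toList⁺ y∈Y)) , ∈-fromList⁺ (∈-++⁺ʳ (toList Y) (∈-map⁺ neighbour (∈-toList⁺ y∈Y)))

  ∈-addNeighbours⁻ : ∀ {Y v} → v ∈ addNeighbours Y → ∃ λ y → y ∈ Y × (v ≡ y ⊎ v ≡ neighbour y)
  ∈-addNeighbours⁻ {Y} v∈ with ∈-++⁻ (toList Y) (∈-fromList⁻ (toList Y ++ map neighbour (toList Y)) v∈)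
  ... | inj₁ v∈Y  = _ , ∈-toList⁻ v∈Y , inj₁ refl
  ... | inj₂ v∈nY with y , y∈Y , v≡ny ← ∈-map⁻ neighbour v∈nY = y , ∈-toList⁻ y∈Y , inj₂ v≡ny

  ⊆-addNeighbours : ∀ Y → Y ⊆ addNeighbours Y
  ⊆-addNeighbours Y = proj₁ ∘ ∈-addNeighbours⁺

  ∣addNeighbours∣≤ : ∀ Y → ∣ addNeighbours Y ∣ ≤ 2 * ∣ Y ∣
  ∣addNeighbours∣≤ Y = ≤-trans (∣fromList∣≤length (ys ++ map neighbour ys)) (≤-reflexive (begin
    length (ys ++ map neighbour ys)          ≡⟨ length-++ ys ⟩
    length ys + length (map neighbour ys)    ≡⟨ cong (λ l → length ys + l) (length-map neighbour ys) ⟩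
    length ys + length ys                    ≡⟨ cong (λ l → l + l) (length-toList Y) ⟩
    ∣ Y ∣ + ∣ Y ∣                            ≡⟨ cong (λ l → ∣ Y ∣ + l) (sym (+-identityʳ ∣ Y ∣)) ⟩
    2 * ∣ Y ∣                                ∎))
    where
    open ≡-Reasoning
    ys : List (Fin n)
    ys = toList Y

  neighbourPair-NoNewIsolated : ∀ {X y v} → y ∈ X → neighbour y ∈ X → v ≡ y ⊎ v ≡ neighbour y →
    HasNeighbourIn ⊤ v → HasNeighbourIn X v
  neighbourPair-NoNewIsolated {y = y} y∈X ny∈X v∈pair v-active with neighbour-spec y | v∈pair
  ... | inj₁ y~ny              | inj₁ refl = neighbour y , ny∈X , y~ny
  ... | inj₁ y~ny              | inj₂ refl = y , y∈X , adj-sym y~ny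
  ... | inj₂ (_ , isolated)    | inj₁ refl = contradiction v-active isolated
  ... | inj₂ (ny≡y , isolated) | inj₂ refl = contradiction (subst (HasNeighbourIn ⊤) ny≡y v-active) isolated

  addNeighbours-NoNewIsolated : ∀ Y → NoNewIsolated (addNeighbours Y)
  addNeighbours-NoNewIsolated Y v∈X with y , y∈Y , v∈pair ← ∈-addNeighbours⁻ v∈X =
    let y∈X , ny∈X = ∈-addNeighbours⁺ y∈Y in neighbourPair-NoNewIsolated y∈X ny∈X v∈pair

  coloredNeighbours : Subset n → Coloring n → Fin n → ℕ → List (Fin n)
  coloredNeighbours W φ v a =
    filter (_∈? W) (filter (λ u → φ u ℕ.≟ a) (filter (λ u → adj G v u ≟ᵇ true) (allFin n)))

  ∈-coloredNeighbours⁺ : ∀ {W φ v a u} → T (adj G v u) → φ u ≡ a → u ∈ W → u ∈ₗ coloredNeighbours W φ v a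
  ∈-coloredNeighbours⁺ {W} {φ} {v} {a} v~u φu≡a u∈W =
    ∈-filter⁺ (_∈? W) (∈-filter⁺ (λ u → φ u ℕ.≟ a)
      (∈-filter⁺ (λ u → adj G v u ≟ᵇ true) (∈-allFin _) (to T-≡ v~u)) φu≡a) u∈W

  ∈-coloredNeighbours⁻ : ∀ {W φ v a u} → u ∈ₗ coloredNeighbours W φ v a → T (adj G v u) × φ u ≡ a × u ∈ W
  ∈-coloredNeighbours⁻ {W} {φ} {v} {a} u∈ =
    let u∈₂ , u∈W  = ∈-filter⁻ (_∈? W) {xs = filter (λ u → φ u ℕ.≟ a) neighbours} u∈
        u∈₁ , φu≡a = ∈-filter⁻ (λ u → φ u ℕ.≟ a) {xs = neighbours} u∈₂
        _   , v~u  = ∈-filter⁻ (λ u → adj G v u ≟ᵇ true) {xs = allFin n} u∈₁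
    in from T-≡ v~u , φu≡a , u∈W
    where
    neighbours : List (Fin n)
    neighbours = filter (λ u → adj G v u ≟ᵇ true) (allFin n)

  coloredNeighbours-Unique : ∀ W φ v a → Unique (coloredNeighbours W φ v a)
  coloredNeighbours-Unique W φ v a =
    filter⁺ (_∈? W) (filter⁺ (λ u → φ u ℕ.≟ a) (filter⁺ (λ u → adj G v u ≟ᵇ true) (allFin⁺ n)))

  countColor-cong : ∀ {W W′ φ φ′ v a a′} →
    (∀ {u} → T (adj G v u) → (φ u ≡ a × u ∈ W) ⇔ (φ′ u ≡ a′ × u ∈ W′)) →
    countColor G W φ v a ≡ countColor G W′ φ′ v a′
  countColor-cong {W} {W′} {φ} {φ′} {v} {a} {a′} same =
    Unique-⊆-antisym⇒length≡ Fin._≟_ (coloredNeighbours-Unique W φ v a) (coloredNeighbours-Unique W′ φ′ v a′)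
      (transfer (to ∘ same)) (transfer (from ∘ same))
    where
    transfer : ∀ {W₁ W₂ φ₁ φ₂ a₁ a₂} →
      (∀ {u} → T (adj G v u) → φ₁ u ≡ a₁ × u ∈ W₁ → φ₂ u ≡ a₂ × u ∈ W₂) →
      coloredNeighbours W₁ φ₁ v a₁ ⊆ₗ coloredNeighbours W₂ φ₂ v a₂
    transfer one-way u∈ with v~u , φu≡a , u∈W ← ∈-coloredNeighbours⁻ u∈ =
      let φ′u≡a′ , u∈W′ = one-way v~u (φu≡a , u∈W) in ∈-coloredNeighbours⁺ v~u φ′u≡a′ u∈W′

  countColor≡1 : ∀ {W φ v a w} → w ∈ W → T (adj G v w) → φ w ≡ a →
    (∀ {u} → u ∈ W → T (adj G v u) → φ u ≡ a → u ≡ w) → countColor G W φ v a ≡ 1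
  countColor≡1 {W} {φ} {v} {a} w∈W v~w φw≡a only-w =
    Unique-⊆-antisym⇒length≡ Fin._≟_ (coloredNeighbours-Unique W φ v a) ([] ∷ [])
      (λ u∈ → let v~u , φu≡a , u∈W = ∈-coloredNeighbours⁻ u∈ in here (only-w u∈W v~u φu≡a))
      (λ { (here refl) → ∈-coloredNeighbours⁺ v~w φw≡a w∈W })

  module _ {X : Subset n} {g ψ : Coloring n}
           (g-inj : ∀ {z w} → z ∈ X → w ∈ X → g z ≡ g w → z ≡ w)
           (apart : ∀ {z w} → z ∉ X → w ∈ X → ψ z ≢ g w) where

    merge-Proper : Proper G (∁ X) ψ → Proper G ⊤ (merge X g ψ)
    merge-Proper ψ-proper u v _ _ u~v =
      merge-elim (_≢ merge X g ψ v)
        (λ u∈X → merge-elim (g u ≢_) (λ v∈X → adj-irrefl u~v ∘ g-inj u∈X v∈X) (λ v∉X → apart v∉X u∈X ∘ sym))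
        (λ u∉X → merge-elim (ψ u ≢_) (apart u∉X)
                   (λ v∉X → ψ-proper u v (x∉p⇒x∈∁p u∉X) (x∉p⇒x∈∁p v∉X) u~v))
      where
      adj-irrefl : ∀ {u v} → T (adj G u v) → u ≢ v
      adj-irrefl {u} u~u refl = subst T (irrfl G u) u~u

    countColor-merge-∈ : ∀ {v w} → w ∈ X → T (adj G v w) → countColor G ⊤ (merge X g ψ) v (g w) ≡ 1
    countColor-merge-∈ {v} {w} w∈X v~w = countColor≡1 ∈⊤ v~w (merge-∈ w∈X) only-w
      where
      only-w : ∀ {u} → u ∈ ⊤ → T (adj G v u) → merge X g ψ u ≡ g w → u ≡ w
      only-w {u} _ _ = merge-elim (λ c → c ≡ g w → u ≡ w)
        (λ u∈X → g-inj u∈X w∈X) (λ u∉X ψu≡gw → contradiction ψu≡gw (apart u∉X w∈X))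

    countColor-merge-∉ : ∀ {v a} → ¬ HasNeighbourIn X v →
      countColor G ⊤ (merge X g ψ) v a ≡ countColor G (∁ X) ψ v a
    countColor-merge-∉ no-neighbour-in-X = countColor-cong λ v~u →
      let u∉X = λ u∈X → no-neighbour-in-X (_ , u∈X , v~u) in
      mk⇔ (λ (φu≡a , _) → trans (sym (merge-∉ u∉X)) φu≡a , x∉p⇒x∈∁p u∉X)
          (λ (ψu≡a , _) → trans (merge-∉ u∉X) ψu≡a , ∈⊤)

    merge-SAchieved : ∀ S → S (+ 1) → NoNewIsolated X →
      SAchieved S G (∁ X) ψ → SAchieved S G ⊤ (merge X g ψ)
    merge-SAchieved S S1 X-ok ψ-ach v _ (u , _ , v~u) with Fin.any? (λ w → (w ∈? X) ×-dec T? (adj G v w))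
    ... | yes (w , w∈X , v~w) = g w , subst (S ∘ +_) (sym (countColor-merge-∈ w∈X v~w)) S1
    ... | no no-neighbour-in-X =
      map₂ (subst (S ∘ +_) (sym (countColor-merge-∉ no-neighbour-in-X)))
           (ψ-ach v (x∉p⇒x∈∁p v∉X) (u , x∉p⇒x∈∁p (λ u∈X → no-neighbour-in-X (u , u∈X , v~u)) , v~u))
      where
      v∉X : v ∉ X
      v∉X v∈X = no-neighbour-in-X (X-ok v∈X (u , ∈⊤ , v~u))

  module _ (S : IntSet) (S1 : S (+ 1)) {X : Subset n} (X-ok : NoNewIsolated X)
           {m : ℕ} (∣X∣≤m : ∣ X ∣ ≤ m) where

    SAchChoosable-extend : ∀ {c} → SAchChoosable S G (∁ X) c → SAchChoosable S G ⊤ (c + m)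
    SAchChoosable-extend {c} choose-rest L L! L-long =
      let ψ , ψ-proper , ψ-ach , ψ∈L′ = choose-rest L′ (λ v _ → filter⁺ (_∉ₗ? C) (L! v ∈⊤)) (λ v _ → L′-long v)
          apart = avoids-C ψ∈L′
      in merge X g ψ , merge-Proper g-inj apart ψ-proper , merge-SAchieved g-inj apart S S1 X-ok ψ-ach ,
         λ v _ → merge-elim (_∈ₗ L v) g∈L (λ v∉X → proj₁ (∈-filter⁻ (_∉ₗ? C) (ψ∈L′ v (x∉p⇒x∈∁p v∉X))))
      where
      open DecMembership ℕ._≟_ using () renaming (_∉?_ to _∉ₗ?_)
      open Representatives
        (distinctRepresentativesOn X ∣X∣≤m L (λ _ → L! _ ∈⊤) (λ _ → ≤-trans (m≤n+m m c) (L-long _ ∈⊤)))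
        renaming (rep to g; rep∈L to g∈L; rep-injective to g-inj)

      C : List ℕ
      C = map g (toList X)

      L′ : Fin n → List ℕ
      L′ v = filter (_∉ₗ? C) (L v)

      length-C : length C ≡ ∣ X ∣
      length-C = trans (length-map g (toList X)) (length-toList X)

      L′-long : ∀ v → c ≤ length (L′ v)
      L′-long v = +-cancelʳ-≤ m c (length (L′ v)) (begin
        c + m                       ≤⟨ L-long v ∈⊤ ⟩
        length (L v)                ≤⟨ length≤length-filter-∉+length ℕ._≟_ C (L! v ∈⊤) ⟩
        length (L′ v) + length C    ≡⟨ cong (λ l → length (L′ v) + l) length-C ⟩
        length (L′ v) + ∣ X ∣       ≤⟨ +-monoʳ-≤ (length (L′ v)) ∣X∣≤m ⟩
        length (L′ v) + m           ∎)
        where open ≤-Reasoning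

      avoids-C : ∀ {ψ : Coloring n} → (∀ v → v ∈ ∁ X → ψ v ∈ₗ L′ v) → ∀ {z w} → z ∉ X → w ∈ X → ψ z ≢ g w
      avoids-C ψ∈L′ {z} z∉X w∈X ψz≡gw = proj₂ (∈-filter⁻ (_∉ₗ? C) {xs = L z} (ψ∈L′ z (x∉p⇒x∈∁p z∉X)))
        (subst (_∈ₗ C) (sym ψz≡gw) (∈-map⁺ g (∈-toList⁺ w∈X)))

    PropSAchColorable-extend : ∀ {c} → PropSAchColorable S G (∁ X) c → PropSAchColorable S G ⊤ (c + m)
    PropSAchColorable-extend {c} (ψ , ψ-proper , ψ-ach , ψ-range) =
      merge X g ψ , merge-Proper g-inj apart ψ-proper , merge-SAchieved g-inj apart S S1 X-ok ψ-ach , range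
      where
      open Representatives
        (distinctRepresentativesOn X ∣X∣≤m (λ _ → colorInterval c m)
          (λ _ → colorInterval-Unique c m) (λ _ → ≤-reflexive (sym (length-applyUpTo _ m))))
        renaming (rep to g; rep∈L to g∈L; rep-injective to g-inj)

      apart : ∀ {z w} → z ∉ X → w ∈ X → ψ z ≢ g w
      apart z∉X w∈X ψz≡gw =
        <⇒≱ (proj₁ (∈-colorInterval⁻ (g∈L w∈X))) (subst (_≤ c) ψz≡gw (proj₂ (ψ-range _ (x∉p⇒x∈∁p z∉X))))

      range : ∀ v → v ∈ ⊤ → 1 ≤ merge X g ψ v × merge X g ψ v ≤ c + m
      range v _ = merge-elim (λ a → 1 ≤ a × a ≤ c + m)
        (λ v∈X → let c<gv , gv≤c+m = ∈-colorInterval⁻ (g∈L v∈X) in ≤-trans (s≤s z≤n) c<gv , gv≤c+m)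
        (λ v∉X → let 1≤ψv , ψv≤c = ψ-range v (x∉p⇒x∈∁p v∉X) in 1≤ψv , ≤-trans ψv≤c (m≤m+n c m))

lemma4p1 : (S : IntSet) → S (+ 1) → {n : ℕ} → (G : Graph n) → (k c : ℕ) →
    (Y : Subset n) → ∣ Y ∣ ≤ k →
    ((∀ (X : Subset n) → Y ⊆ X → ∣ X ∣ ≤ 2 * ∣ Y ∣ → SAchChoosable S G (∁ X) c) →
      SAchChoosable S G ⊤ (c + 2 * k))
    × ((∀ (X : Subset n) → Y ⊆ X → ∣ X ∣ ≤ 2 * ∣ Y ∣ → PropSAchColorable S G (∁ X) c) →
      PropSAchColorable S G ⊤ (c + 2 * k))
lemma4p1 S S1 {n} G k c Y ∣Y∣≤k =
  (λ choose → SAchChoosable-extend G S S1 X-ok ∣X∣≤2k (choose X Y⊆X ∣X∣≤2∣Y∣)) ,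
  (λ color → PropSAchColorable-extend G S S1 X-ok ∣X∣≤2k (color X Y⊆X ∣X∣≤2∣Y∣))
  where
  X : Subset n
  X = addNeighbours G Y

  Y⊆X : Y ⊆ X
  Y⊆X = ⊆-addNeighbours G Y

  X-ok : NoNewIsolated G X
  X-ok = addNeighbours-NoNewIsolated G Y

  ∣X∣≤2∣Y∣ : ∣ X ∣ ≤ 2 * ∣ Y ∣
  ∣X∣≤2∣Y∣ = ∣addNeighbours∣≤ G Y

  ∣X∣≤2k : ∣ X ∣ ≤ 2 * k
  ∣X∣≤2k = ≤-trans ∣X∣≤2∣Y∣ (*-monoʳ-≤ 2 ∣Y∣≤k)
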